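{- If $n\ge 6$, then $(n,\lfloor 3n/2\rfloor+2)\rightarrow(5,9)$; that is, for every family $\mathcal F\subseteq 2^{[n]}$ with $|\mathcal F|=\lfloor 3n/2\rfloor+2$ there is a $5$-element set $X\subseteq[n]$ with $|\{F\cap X:F\in\mathcal F\}|\ge 9$.
   Context: The arrow relation $(n,m)\rightarrow(k,l)$ means: for every family $\mathcal F\subseteq 2^{[n]}$ with $|\mathcal F|=m$ there is a $k$-element set $X\subseteq[n]$ with $|\{F\cap X:F\in\mathcal F\}|\ge l$. -}

module Defs where

open import Data.Nat using (ℕ; _≥_)
open import Data.Bool.Properties using () renaming (_≟_ to _≟ᵇ_)
open import Data.List using (List; map; length; deduplicate)
open import Data.List.Relation.Unary.Unique.Propositional using (Unique)
open import Data.Fin.Subset using (Subset; _∩_; ∣_∣)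
open import Data.Vec.Properties using (≡-dec)
open import Relation.Binary.PropositionalEquality using (_≡_)
open import Data.Product using (_×_; Σ-syntax)

_≟ˢ_ : ∀ {n} → (A B : Subset n) → _
_≟ˢ_ = ≡-dec _≟ᵇ_

-- a family F ⊆ 2^[n] : a duplicate-free list of subsets of [n]
-- its size is the length of the list.

trace : ∀ {n} → List (Subset n) → Subset n → List (Subset n)
trace {n} 𝓕 X = deduplicate _≟ˢ_ (map (λ F → F ∩ X) 𝓕)

traceSize : ∀ {n} → List (Subset n) → Subset n → ℕ
traceSize 𝓕 X = length (trace 𝓕 X)

Arrow : ℕ → ℕ → ℕ → ℕ → Set
Arrow n m k l =
  (𝓕 : List (Subset n)) → Unique 𝓕 → length 𝓕 ≡ m →
  Σ[ X ∈ Subset n ] (∣ X ∣ ≡ k × traceSize 𝓕 X ≥ l)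

module Submission where

-- Iterated down-shifting (compress) turns a family into a
-- down-closed family with the same number of members which, for every X,
-- has at most as many members inside X as the original family has traces
-- on X (compress-within≤traces).  So it suffices to find, in a down-closed
-- family ψ, a five-set X containing nine members of ψ.
--
-- Let V be the set of
-- points whose singleton lies in ψ; all members of ψ lie inside V.  If
-- ∣V∣ < 5, any five-set X ⊇ V contains all ≥ 9 members.  Otherwise it
-- suffices to find a core: a set U ⊆ V of at most five points containing
-- three pairs of ψ; a five-set between U and V then contains ∅, five
-- singletons and three pairs.  A member of size ≥ 3 contains a core.  If
-- there is none, ψ has at most 1 + n members of size ≤ 1, hence more than
-- n/2 pairs; by pigeonhole two pairs share a point, and with a third pair
-- they span at most five points.

open import Algebra.Bundles using (CommutativeMonoid)
open import Data.Bool using (Bool; true; false; T; _∧_; _∨_)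
open import Data.Bool.Properties
  using (T-≡; T-∧; T-∨; ∧-zeroʳ; ∧-identityʳ; ∨-commutativeMonoid)
open import Data.Empty using (⊥-elim)
open import Data.Fin using (Fin; zero; suc)
open import Data.Fin.Subset
  using (Subset; inside; outside; _∈_; _⊆_; _∩_; _∪_; ∣_∣; ⁅_⁆; Nonempty)
  renaming (⊥ to ∅)
open import Data.Fin.Subset.Properties
  using ( _⊆?_; drop-∷-⊆; s⊆s; out⊆; ⊆-refl; ⊆-trans; ⊥⊆; ⊆⊤; p⊆p∪q; q⊆p∪q
        ; p⊆q⇒∣p∣≤∣q∣; ∣p∣≤n; ∣⊥∣≡0; ∣⊤∣≡n; ∣⁅x⁆∣≡1
        ; x∈⁅x⁆; x∈⁅y⁆⇒x≡y; x∈p∩q⁺; x∈p∪q⁻)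
open import Data.List using (List; []; _∷_; length)
open import Data.List.Membership.Propositional using () renaming (_∈_ to _∈ˡ_; _∉_ to _∉ˡ_)
open import Data.List.Membership.Propositional.Properties using (∈-map⁺; ∈-deduplicate⁺)
open import Data.List.Relation.Unary.All as All using ([]; _∷_)
open import Data.List.Relation.Unary.AllPairs using ([]; _∷_)
open import Data.List.Relation.Unary.Any using (here; there)
open import Data.List.Relation.Unary.Unique.Propositional using (Unique)
import Data.List.Relation.Unary.Unique.DecPropositional.Properties as UniqueDec
open import Data.Nat
  using (ℕ; zero; suc; _+_; _*_; _/_; _%_; _≤_; _<_; _≥_; z≤n; s≤s; _≟_; _≤?_; _<?_)
open import Data.Nat.Combinatorics
  using (nCk+nC[k+1]≡[n+1]C[k+1]; nC1≡n) renaming (_C_ to _choose_)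
open import Data.Nat.DivMod using (m≡m%n+[m/n]*n; m%n<n; /-monoˡ-≤)
open import Data.Nat.Properties
open import Data.Nat.Tactic.RingSolver using (solve-∀)
open import Data.Product using (_×_; _,_; proj₁; proj₂; Σ-syntax)
open import Data.Sum using (_⊎_; inj₁; inj₂; [_,_])
open import Data.Unit using (tt)
import Data.Vec as Vec
open import Data.Vec using ([]; _∷_; tabulate)
open import Data.Vec.Properties using (∷-injectiveʳ; lookup∘tabulate; []=⇒lookup; lookup⇒[]=)
open import Function using (_∘_; id; Equivalence)
open import Relation.Binary.PropositionalEquality
  using (_≡_; _≢_; refl; sym; trans; cong; cong₂; subst; module ≡-Reasoning)
open import Relation.Nullary using (¬_; Dec; does; yes; no; contradiction)
open import Algebra.Properties.CommutativeSemigroup +-commutativeSemigroup using (interchange)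
open import Algebra.Properties.CommutativeSemigroup
  (CommutativeMonoid.commutativeSemigroup ∨-commutativeMonoid)
  using () renaming (interchange to ∨-interchange)

open import Defs

∑ : ∀ {n} → (Subset n → ℕ) → ℕ
∑ {zero}  f = f []
∑ {suc n} f = ∑ (f ∘ (outside ∷_)) + ∑ (f ∘ (inside ∷_))

∑-cong : ∀ {n} {f g : Subset n → ℕ} → (∀ A → f A ≡ g A) → ∑ f ≡ ∑ g
∑-cong {zero}  f≡g = f≡g []
∑-cong {suc n} f≡g = cong₂ _+_ (∑-cong (f≡g ∘ (outside ∷_))) (∑-cong (f≡g ∘ (inside ∷_)))

∑-mono : ∀ {n} {f g : Subset n → ℕ} → (∀ A → f A ≤ g A) → ∑ f ≤ ∑ g
∑-mono {zero}  f≤g = f≤g []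
∑-mono {suc n} f≤g = +-mono-≤ (∑-mono (f≤g ∘ (outside ∷_))) (∑-mono (f≤g ∘ (inside ∷_)))

∑-zero : ∀ {n} → ∑ {n} (λ _ → 0) ≡ 0
∑-zero {zero}  = refl
∑-zero {suc n} = cong₂ _+_ (∑-zero {n}) (∑-zero {n})

∑-+ : ∀ {n} (f g : Subset n → ℕ) → ∑ (λ A → f A + g A) ≡ ∑ f + ∑ g
∑-+ {zero}  f g = refl
∑-+ {suc n} f g = begin
  ∑ (λ A → f₀ A + g₀ A) + ∑ (λ A → f₁ A + g₁ A) ≡⟨ cong₂ _+_ (∑-+ f₀ g₀) (∑-+ f₁ g₁) ⟩
  (∑ f₀ + ∑ g₀) + (∑ f₁ + ∑ g₁)                 ≡⟨ interchange (∑ f₀) (∑ g₀) (∑ f₁) (∑ g₁) ⟩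
  (∑ f₀ + ∑ f₁) + (∑ g₀ + ∑ g₁)                 ∎
  where
  open ≡-Reasoning
  f₀ f₁ g₀ g₁ : Subset n → ℕ
  f₀ = f ∘ (outside ∷_)
  f₁ = f ∘ (inside ∷_)
  g₀ = g ∘ (outside ∷_)
  g₁ = g ∘ (inside ∷_)

∑-*ˡ : ∀ {n} k (f : Subset n → ℕ) → ∑ (λ A → k * f A) ≡ k * ∑ f
∑-*ˡ {zero}  k f = refl
∑-*ˡ {suc n} k f =
  trans (cong₂ _+_ (∑-*ˡ k (f ∘ (outside ∷_))) (∑-*ˡ k (f ∘ (inside ∷_))))
        (sym (*-distribˡ-+ k _ _))

∑-<-witness : ∀ {n} (f g : Subset n → ℕ) → ∑ g < ∑ f → Σ[ A ∈ Subset n ] g A < f A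
∑-<-witness {zero}  f g g<f = [] , g<f
∑-<-witness {suc n} f g g<f with ∑ (g ∘ (outside ∷_)) <? ∑ (f ∘ (outside ∷_))
... | yes g₀<f₀ = let A , gA<fA = ∑-<-witness _ _ g₀<f₀ in outside ∷ A , gA<fA
... | no  g₀≮f₀ = let A , gA<fA = ∑-<-witness _ _ g₁<f₁ in inside ∷ A , gA<fA
  where
  g₁<f₁ : ∑ (g ∘ (inside ∷_)) < ∑ (f ∘ (inside ∷_))
  g₁<f₁ = +-cancelˡ-< (∑ (g ∘ (outside ∷_))) _ _
            (<-≤-trans g<f (+-monoˡ-≤ _ (≮⇒≥ g₀≮f₀)))

does⇒ : ∀ {p} {P : Set p} (P? : Dec P) → T (does P?) → P
does⇒ (yes p) _ = p

⇒does : ∀ {p} {P : Set p} (P? : Dec P) → P → T (does P?)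
⇒does (yes _) _ = tt
⇒does (no ¬p) p = ¬p p

Family : ℕ → Set
Family n = Subset n → Bool

infix  4 _∈ᶠ_ _⊑_
infixr 6 _∪ᶠ_
infixr 7 _∩ᶠ_

_∈ᶠ_ : ∀ {n} → Subset n → Family n → Set
A ∈ᶠ φ = T (φ A)

_⊑_ : ∀ {n} → Family n → Family n → Set
φ ⊑ ψ = ∀ A → A ∈ᶠ φ → A ∈ᶠ ψ

_∪ᶠ_ _∩ᶠ_ : ∀ {n} → Family n → Family n → Family n
(φ ∪ᶠ ψ) A = φ A ∨ ψ A
(φ ∩ᶠ ψ) A = φ A ∧ ψ A

∈∪ᶠ⁻ : ∀ {n} (φ ψ : Family n) A → A ∈ᶠ φ ∪ᶠ ψ → A ∈ᶠ φ ⊎ A ∈ᶠ ψ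
∈∪ᶠ⁻ φ ψ A = Equivalence.to (T-∨ {φ A})

∈∪ᶠ⁺ : ∀ {n} (φ ψ : Family n) A → A ∈ᶠ φ ⊎ A ∈ᶠ ψ → A ∈ᶠ φ ∪ᶠ ψ
∈∪ᶠ⁺ φ ψ A = Equivalence.from (T-∨ {φ A})

∈∩ᶠ⁻ : ∀ {n} (φ ψ : Family n) A → A ∈ᶠ φ ∩ᶠ ψ → A ∈ᶠ φ × A ∈ᶠ ψ
∈∩ᶠ⁻ φ ψ A = Equivalence.to (T-∧ {φ A})

∈∩ᶠ⁺ : ∀ {n} (φ ψ : Family n) A → A ∈ᶠ φ → A ∈ᶠ ψ → A ∈ᶠ φ ∩ᶠ ψ
∈∩ᶠ⁺ φ ψ A A∈φ A∈ψ = Equivalence.from (T-∧ {φ A}) (A∈φ , A∈ψ)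

∪ᶠ-mono : ∀ {n} {φ φ′ ψ ψ′ : Family n} → φ ⊑ φ′ → ψ ⊑ ψ′ → φ ∪ᶠ ψ ⊑ φ′ ∪ᶠ ψ′
∪ᶠ-mono {φ = φ} {φ′} {ψ} {ψ′} φ⊑φ′ ψ⊑ψ′ A A∈ with ∈∪ᶠ⁻ φ ψ A A∈
... | inj₁ A∈φ = ∈∪ᶠ⁺ φ′ ψ′ A (inj₁ (φ⊑φ′ A A∈φ))
... | inj₂ A∈ψ = ∈∪ᶠ⁺ φ′ ψ′ A (inj₂ (ψ⊑ψ′ A A∈ψ))

∩ᶠ-mono : ∀ {n} {φ φ′ ψ ψ′ : Family n} → φ ⊑ φ′ → ψ ⊑ ψ′ → φ ∩ᶠ ψ ⊑ φ′ ∩ᶠ ψ′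
∩ᶠ-mono {φ = φ} {φ′} {ψ} {ψ′} φ⊑φ′ ψ⊑ψ′ A A∈ =
  let A∈φ , A∈ψ = ∈∩ᶠ⁻ φ ψ A A∈ in ∈∩ᶠ⁺ φ′ ψ′ A (φ⊑φ′ A A∈φ) (ψ⊑ψ′ A A∈ψ)

∩⊑∪ : ∀ {n} (φ ψ : Family n) → φ ∩ᶠ ψ ⊑ φ ∪ᶠ ψ
∩⊑∪ φ ψ A A∈ = ∈∪ᶠ⁺ φ ψ A (inj₁ (proj₁ (∈∩ᶠ⁻ φ ψ A A∈)))

_⁰ _¹ : ∀ {n} → Family (suc n) → Family n
(φ ⁰) A = φ (outside ∷ A)
(φ ¹) A = φ (inside ∷ A)

𝟙 : Bool → ℕ
𝟙 true  = 1
𝟙 false = 0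

count : ∀ {n} → Family n → ℕ
count φ = ∑ (𝟙 ∘ φ)

count-mono : ∀ {n} {φ ψ : Family n} → φ ⊑ ψ → count φ ≤ count ψ
count-mono φ⊑ψ = ∑-mono (λ A → 𝟙-mono (φ⊑ψ A))
  where
  𝟙-mono : ∀ {a b} → (T a → T b) → 𝟙 a ≤ 𝟙 b
  𝟙-mono {false}        _   = z≤n
  𝟙-mono {true} {true}  _   = ≤-refl
  𝟙-mono {true} {false} a⇒b = ⊥-elim (a⇒b tt)

count-∪∩ : ∀ {n} (φ ψ : Family n) → count (φ ∪ᶠ ψ) + count (φ ∩ᶠ ψ) ≡ count φ + count ψ
count-∪∩ φ ψ = begin
  count (φ ∪ᶠ ψ) + count (φ ∩ᶠ ψ)           ≡⟨ ∑-+ (𝟙 ∘ (φ ∪ᶠ ψ)) (𝟙 ∘ (φ ∩ᶠ ψ)) ⟨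
  ∑ (λ A → 𝟙 (φ A ∨ ψ A) + 𝟙 (φ A ∧ ψ A))   ≡⟨ ∑-cong (λ A → 𝟙-∨∧ (φ A) (ψ A)) ⟩
  ∑ (λ A → 𝟙 (φ A) + 𝟙 (ψ A))               ≡⟨ ∑-+ (𝟙 ∘ φ) (𝟙 ∘ ψ) ⟩
  count φ + count ψ                         ∎
  where
  open ≡-Reasoning
  𝟙-∨∧ : ∀ a b → 𝟙 (a ∨ b) + 𝟙 (a ∧ b) ≡ 𝟙 a + 𝟙 b
  𝟙-∨∧ false b     = +-identityʳ (𝟙 b)
  𝟙-∨∧ true  false = refl
  𝟙-∨∧ true  true  = refl

count-witness : ∀ {n} (φ ψ : Family n) → count ψ < count φ →
                Σ[ A ∈ Subset n ] (A ∈ᶠ φ × ¬ A ∈ᶠ ψ)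
count-witness φ ψ ψ<φ =
  let A , ψA<φA = ∑-<-witness (𝟙 ∘ φ) (𝟙 ∘ ψ) ψ<φ in A , 𝟙-< (φ A) (ψ A) ψA<φA
  where
  𝟙-< : ∀ a b → 𝟙 b < 𝟙 a → T a × ¬ T b
  𝟙-< true  false _ = tt , λ ()
  𝟙-< true  true  (s≤s ())
  𝟙-< false b     ()

module _ {n : ℕ} where
  open import Data.List.Membership.DecPropositional (_≟ˢ_ {n}) using (_∈?_)

  ｛_｝ : Subset n → Family n
  ｛ x ｝ A = does (A ≟ˢ x)

  ⟪_⟫ : List (Subset n) → Family n
  ⟪ L ⟫ A = does (A ∈? L)

  ∈｛｝ : ∀ x A → A ∈ᶠ ｛ x ｝ → A ≡ x
  ∈｛｝ x A = does⇒ (A ≟ˢ x)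

  ∈⟪⟫ : ∀ L A → A ∈ᶠ ⟪ L ⟫ → A ∈ˡ L
  ∈⟪⟫ L A = does⇒ (A ∈? L)

  ⟪⟫∋ : ∀ L A → A ∈ˡ L → A ∈ᶠ ⟪ L ⟫
  ⟪⟫∋ L A = ⇒does (A ∈? L)

count-｛｝ : ∀ {n} (x : Subset n) → count ｛ x ｝ ≡ 1
count-｛｝ []                    = refl
count-｛｝ {suc n} (outside ∷ x) = cong₂ _+_ (count-｛｝ x) (∑-zero {n})
count-｛｝ {suc n} (inside  ∷ x) = cong₂ _+_ (∑-zero {n}) (count-｛｝ x)

-- A duplicate-free list of k sets describes a family with k members: the
-- head is a singleton disjoint from the family of the tail.
count-⟪⟫ : ∀ {n} (L : List (Subset n)) → Unique L → count ⟪ L ⟫ ≡ length L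
count-⟪⟫ {n} []      []            = ∑-zero {n}
count-⟪⟫ {n} (x ∷ L) (x∉L ∷ uniq) = begin
  count ⟪ x ∷ L ⟫                                  ≡⟨ +-identityʳ _ ⟨
  count (｛ x ｝ ∪ᶠ ⟪ L ⟫) + 0                      ≡⟨ cong (count ⟪ x ∷ L ⟫ +_) disjoint ⟨
  count (｛ x ｝ ∪ᶠ ⟪ L ⟫) + count (｛ x ｝ ∩ᶠ ⟪ L ⟫) ≡⟨ count-∪∩ ｛ x ｝ ⟪ L ⟫ ⟩
  count ｛ x ｝ + count ⟪ L ⟫                       ≡⟨ cong₂ _+_ (count-｛｝ x) (count-⟪⟫ L uniq) ⟩
  length (x ∷ L)                                   ∎
  where
  open ≡-Reasoning
  never : ｛ x ｝ ∩ᶠ ⟪ L ⟫ ⊑ (λ _ → false)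
  never A A∈ =
    let A∈x , A∈L = ∈∩ᶠ⁻ ｛ x ｝ ⟪ L ⟫ A A∈
    in All.lookup x∉L (subst (_∈ˡ L) (∈｛｝ x A A∈x) (∈⟪⟫ L A A∈L)) refl
  disjoint : count (｛ x ｝ ∩ᶠ ⟪ L ⟫) ≡ 0
  disjoint = n≤0⇒n≡0 (≤-trans (count-mono never) (≤-reflexive (∑-zero {n})))

length≤count : ∀ {n} {φ : Family n} (L : List (Subset n)) → Unique L →
               (∀ {A} → A ∈ˡ L → A ∈ᶠ φ) → length L ≤ count φ
length≤count L uniq L⊆φ =
  ≤-trans (≤-reflexive (sym (count-⟪⟫ L uniq))) (count-mono (λ A → L⊆φ ∘ ∈⟪⟫ L A))

fresh-member : ∀ {n} (φ : Family n) (L : List (Subset n)) → Unique L →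
               length L < count φ → Σ[ A ∈ Subset n ] (A ∈ᶠ φ × A ∉ˡ L)
fresh-member φ L uniq L<φ =
  let A , A∈φ , A∉L = count-witness φ ⟪ L ⟫ (subst (_< count φ) (sym (count-⟪⟫ L uniq)) L<φ)
  in A , A∈φ , A∉L ∘ ⟪⟫∋ L A

-- traces φ X is the family {A ∩ X : A ∈ φ} of traces of φ on X: a point
-- outside X is projected away by merging the two halves.
traces : ∀ {n} → Family n → Subset n → Family n
traces {zero}  φ []                           = φ
traces {suc n} φ (inside  ∷ X) (s ∷ B)       = traces (λ A → φ (s ∷ A)) X B
traces {suc n} φ (outside ∷ X) (outside ∷ B) = traces (φ ⁰ ∪ᶠ φ ¹) X B
traces {suc n} φ (outside ∷ X) (inside  ∷ B) = false

traces-sound : ∀ {n} (φ : Family n) X B → B ∈ᶠ traces φ X →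
               Σ[ A ∈ Subset n ] (A ∈ᶠ φ × A ∩ X ≡ B)
traces-sound {zero}  φ []            []            B∈ = [] , B∈ , refl
traces-sound {suc n} φ (inside  ∷ X) (s ∷ B)       B∈ =
  let A , A∈ , A∩X≡B = traces-sound _ X B B∈
  in s ∷ A , A∈ , cong₂ _∷_ (∧-identityʳ s) A∩X≡B
traces-sound {suc n} φ (outside ∷ X) (outside ∷ B) B∈
  with traces-sound (φ ⁰ ∪ᶠ φ ¹) X B B∈
... | A , A∈ , A∩X≡B with ∈∪ᶠ⁻ (φ ⁰) (φ ¹) A A∈
...   | inj₁ A∈φ⁰ = outside ∷ A , A∈φ⁰ , cong (outside ∷_) A∩X≡B
...   | inj₂ A∈φ¹ = inside  ∷ A , A∈φ¹ , cong (outside ∷_) A∩X≡B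

traces-mono : ∀ {n} {φ ψ : Family n} X → φ ⊑ ψ → traces φ X ⊑ traces ψ X
traces-mono {zero}  []            φ⊑ψ = φ⊑ψ
traces-mono {suc n} (inside  ∷ X) φ⊑ψ (s ∷ B)       = traces-mono X (φ⊑ψ ∘ (s ∷_)) B
traces-mono {suc n} (outside ∷ X) φ⊑ψ (outside ∷ B) =
  traces-mono X (∪ᶠ-mono (φ⊑ψ ∘ (outside ∷_)) (φ⊑ψ ∘ (inside ∷_))) B
traces-mono {suc n} (outside ∷ X) φ⊑ψ (inside  ∷ B) ()

traces-∪ : ∀ {n} (φ ψ : Family n) X → traces (φ ∪ᶠ ψ) X ⊑ traces φ X ∪ᶠ traces ψ X
traces-∪ {zero}  φ ψ []            = λ _ B∈ → B∈
traces-∪ {suc n} φ ψ (inside  ∷ X) (s ∷ B) = traces-∪ _ _ X B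
traces-∪ {suc n} φ ψ (outside ∷ X) (outside ∷ B) B∈ =
  traces-∪ (φ ⁰ ∪ᶠ φ ¹) (ψ ⁰ ∪ᶠ ψ ¹) X B (traces-mono X regroup B B∈)
  where
  regroup : (φ ∪ᶠ ψ) ⁰ ∪ᶠ (φ ∪ᶠ ψ) ¹ ⊑ (φ ⁰ ∪ᶠ φ ¹) ∪ᶠ (ψ ⁰ ∪ᶠ ψ ¹)
  regroup A = subst T (∨-interchange (φ (outside ∷ A)) (ψ (outside ∷ A))
                                     (φ (inside ∷ A)) (ψ (inside ∷ A)))
traces-∪ {suc n} φ ψ (outside ∷ X) (inside  ∷ B) ()

traces-∩ : ∀ {n} (φ ψ : Family n) X → traces (φ ∩ᶠ ψ) X ⊑ traces φ X ∩ᶠ traces ψ X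
traces-∩ φ ψ X B B∈ = ∈∩ᶠ⁺ (traces φ X) (traces ψ X) B
  (traces-mono X (λ A → proj₁ ∘ ∈∩ᶠ⁻ φ ψ A) B B∈)
  (traces-mono X (λ A → proj₂ ∘ ∈∩ᶠ⁻ φ ψ A) B B∈)

𝒫 : ∀ {n} → Subset n → Family n
𝒫 X A = does (A ⊆? X)

_within_ : ∀ {n} → Family n → Subset n → Family n
φ within X = φ ∩ᶠ 𝒫 X

within-mono : ∀ {n} (φ : Family n) {U X : Subset n} → U ⊆ X → φ within U ⊑ φ within X
within-mono φ {U} {X} U⊆X A A∈ =
  let A∈φ , A⊆U = ∈∩ᶠ⁻ φ (𝒫 U) A A∈
  in ∈∩ᶠ⁺ φ (𝒫 X) A A∈φ (⇒does (A ⊆? X) (⊆-trans (does⇒ (A ⊆? U) A⊆U) U⊆X))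

DownClosed : ∀ {n} → Family n → Set
DownClosed ψ = ∀ {A B} → B ⊆ A → A ∈ᶠ ψ → B ∈ᶠ ψ

-- Iterated down-shifting.  Shifting down in the first coordinate replaces
-- the lower half by φ⁰ ∪ φ¹ and the upper half by φ⁰ ∩ φ¹; both halves are
-- then compressed recursively.
compress : ∀ {n} → Family n → Family n
compress {zero}  φ               = φ
compress {suc n} φ (outside ∷ A) = compress (φ ⁰ ∪ᶠ φ ¹) A
compress {suc n} φ (inside  ∷ A) = compress (φ ⁰ ∩ᶠ φ ¹) A

count-compress : ∀ {n} (φ : Family n) → count (compress φ) ≡ count φ
count-compress {zero}  φ = refl
count-compress {suc n} φ =
  trans (cong₂ _+_ (count-compress (φ ⁰ ∪ᶠ φ ¹)) (count-compress (φ ⁰ ∩ᶠ φ ¹)))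
        (count-∪∩ (φ ⁰) (φ ¹))

compress-mono : ∀ {n} {φ ψ : Family n} → φ ⊑ ψ → compress φ ⊑ compress ψ
compress-mono {zero}  φ⊑ψ = φ⊑ψ
compress-mono {suc n} φ⊑ψ (outside ∷ A) =
  compress-mono (∪ᶠ-mono (φ⊑ψ ∘ (outside ∷_)) (φ⊑ψ ∘ (inside ∷_))) A
compress-mono {suc n} φ⊑ψ (inside  ∷ A) =
  compress-mono (∩ᶠ-mono (φ⊑ψ ∘ (outside ∷_)) (φ⊑ψ ∘ (inside ∷_))) A

-- … produces a down-closed family (the upper half is contained in the
-- lower one) …
compress-downClosed : ∀ {n} (φ : Family n) → DownClosed (compress φ)
compress-downClosed {zero}  φ {[]} {[]} _ A∈ = A∈
compress-downClosed {suc n} φ {outside ∷ A} {outside ∷ B} B⊆A A∈ =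
  compress-downClosed (φ ⁰ ∪ᶠ φ ¹) (drop-∷-⊆ B⊆A) A∈
compress-downClosed {suc n} φ {inside  ∷ A} {inside  ∷ B} B⊆A A∈ =
  compress-downClosed (φ ⁰ ∩ᶠ φ ¹) (drop-∷-⊆ B⊆A) A∈
compress-downClosed {suc n} φ {inside  ∷ A} {outside ∷ B} B⊆A A∈ =
  compress-downClosed (φ ⁰ ∪ᶠ φ ¹) (drop-∷-⊆ B⊆A) (compress-mono (∩⊑∪ (φ ⁰) (φ ¹)) A A∈)
compress-downClosed {suc n} φ {outside ∷ A} {inside  ∷ B} B⊆A A∈ with B⊆A Vec.here
... | ()

compress-within≤traces : ∀ {n} (φ : Family n) X →
                         count (compress φ within X) ≤ count (traces φ X)
compress-within≤traces {zero}  φ [] = ≤-reflexive (cong 𝟙 (∧-identityʳ (φ [])))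
compress-within≤traces {suc n} φ (inside ∷ X) = begin
  count (compress U within X) + count (compress I within X)
    ≤⟨ +-mono-≤ (compress-within≤traces U X) (compress-within≤traces I X) ⟩
  count (traces U X) + count (traces I X)
    ≤⟨ +-mono-≤ (count-mono (traces-∪ (φ ⁰) (φ ¹) X)) (count-mono (traces-∩ (φ ⁰) (φ ¹) X)) ⟩
  count (traces (φ ⁰) X ∪ᶠ traces (φ ¹) X) + count (traces (φ ⁰) X ∩ᶠ traces (φ ¹) X)
    ≡⟨ count-∪∩ (traces (φ ⁰) X) (traces (φ ¹) X) ⟩
  count (traces (φ ⁰) X) + count (traces (φ ¹) X) ∎
  where
  open ≤-Reasoning
  U I : Family n
  U = φ ⁰ ∪ᶠ φ ¹
  I = φ ⁰ ∩ᶠ φ ¹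
compress-within≤traces {suc n} φ (outside ∷ X) =
  +-mono-≤ (compress-within≤traces (φ ⁰ ∪ᶠ φ ¹) X)
           (∑-mono (λ A → ≤-reflexive (cong 𝟙 (∧-zeroʳ (compress (φ ⁰ ∩ᶠ φ ¹) A)))))

count-traces≤traceSize : ∀ {n} (𝓕 : List (Subset n)) X →
                         count (traces ⟪ 𝓕 ⟫ X) ≤ traceSize 𝓕 X
count-traces≤traceSize 𝓕 X = begin
  count (traces ⟪ 𝓕 ⟫ X) ≤⟨ count-mono listed ⟩
  count ⟪ trace 𝓕 X ⟫     ≡⟨ count-⟪⟫ (trace 𝓕 X) (UniqueDec.deduplicate-! _≟ˢ_ _) ⟩
  traceSize 𝓕 X          ∎
  where
  open ≤-Reasoning
  listed : traces ⟪ 𝓕 ⟫ X ⊑ ⟪ trace 𝓕 X ⟫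
  listed B B∈ with traces-sound ⟪ 𝓕 ⟫ X B B∈
  ... | A , A∈𝓕 , refl =
    ⟪⟫∋ (trace 𝓕 X) B (∈-deduplicate⁺ _≟ˢ_ (∈-map⁺ (_∩ X) (∈⟪⟫ 𝓕 A A∈𝓕)))

sized : ∀ {n} → ℕ → Family n
sized j A = does (∣ A ∣ ≟ j)

layer : ∀ {n} → ℕ → Family n → Family n
layer j φ = φ ∩ᶠ sized j

large : ∀ {n} → Family n → Family n
large φ = φ ∩ᶠ λ A → does (3 ≤? ∣ A ∣)

layer-member : ∀ {n} (φ : Family n) j P → P ∈ᶠ layer j φ → P ∈ᶠ φ
layer-member φ j P = proj₁ ∘ ∈∩ᶠ⁻ φ (sized j) P

layer-size : ∀ {n} (φ : Family n) j P → P ∈ᶠ layer j φ → ∣ P ∣ ≡ j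
layer-size φ j P = does⇒ (∣ P ∣ ≟ j) ∘ proj₂ ∘ ∈∩ᶠ⁻ φ (sized j) P

layer-within : ∀ {n} (φ : Family n) j P {X} → P ∈ᶠ layer j φ → P ⊆ X →
               P ∈ᶠ layer j (φ within X)
layer-within φ j P {X} P∈ P⊆X =
  ∈∩ᶠ⁺ (φ within X) (sized j) P
       (∈∩ᶠ⁺ φ (𝒫 X) P (layer-member φ j P P∈) (⇒does (P ⊆? X) P⊆X))
       (proj₂ (∈∩ᶠ⁻ φ (sized j) P P∈))

count-layers : ∀ {n} (φ : Family n) →
  count φ ≡ count (layer 0 φ) + count (layer 1 φ) + count (layer 2 φ) + count (large φ)
count-layers {n} φ = begin
  count φ                                   ≡⟨ ∑-cong (λ A → by-size (φ A) ∣ A ∣) ⟩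
  ∑ (λ A → ℓ 0 A + ℓ 1 A + ℓ 2 A + ℓ₃ A)    ≡⟨ ∑-+ (λ A → ℓ 0 A + ℓ 1 A + ℓ 2 A) ℓ₃ ⟩
  ∑ (λ A → ℓ 0 A + ℓ 1 A + ℓ 2 A) + ∑ ℓ₃    ≡⟨ cong (_+ ∑ ℓ₃) (∑-+ (λ A → ℓ 0 A + ℓ 1 A) (ℓ 2)) ⟩
  ∑ (λ A → ℓ 0 A + ℓ 1 A) + ∑ (ℓ 2) + ∑ ℓ₃  ≡⟨ cong (λ m → m + ∑ (ℓ 2) + ∑ ℓ₃) (∑-+ (ℓ 0) (ℓ 1)) ⟩
  ∑ (ℓ 0) + ∑ (ℓ 1) + ∑ (ℓ 2) + ∑ ℓ₃        ∎
  where
  open ≡-Reasoning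
  ℓ : ℕ → Subset n → ℕ
  ℓ j = 𝟙 ∘ layer j φ
  ℓ₃ : Subset n → ℕ
  ℓ₃ = 𝟙 ∘ large φ
  by-size : ∀ a s → 𝟙 a ≡ 𝟙 (a ∧ does (s ≟ 0)) + 𝟙 (a ∧ does (s ≟ 1))
                         + 𝟙 (a ∧ does (s ≟ 2)) + 𝟙 (a ∧ does (3 ≤? s))
  by-size false s                   = refl
  by-size true  0                   = refl
  by-size true  1                   = refl
  by-size true  2                   = refl
  by-size true  (suc (suc (suc s))) = refl

-- Pascal's rule: a set T has ∣T∣ choose j subsets of size j.
count-layer-𝒫 : ∀ {n} (T : Subset n) j → count (layer j (𝒫 T)) ≡ ∣ T ∣ choose j
count-layer-𝒫 []                    zero    = refl
count-layer-𝒫 []                    (suc j) = refl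
count-layer-𝒫 {suc n} (outside ∷ T) j       =
  trans (cong₂ _+_ (count-layer-𝒫 T j) (∑-zero {n})) (+-identityʳ _)
count-layer-𝒫 {suc n} (inside  ∷ T) zero    =
  cong₂ _+_ (count-layer-𝒫 T zero) (trans (∑-cong (λ A → cong 𝟙 (∧-zeroʳ (𝒫 T A)))) (∑-zero {n}))
count-layer-𝒫 {suc n} (inside  ∷ T) (suc j) =
  trans (cong₂ _+_ (count-layer-𝒫 T (suc j)) (count-layer-𝒫 T j))
        (trans (+-comm (∣ T ∣ choose suc j) (∣ T ∣ choose j)) (nCk+nC[k+1]≡[n+1]C[k+1] ∣ T ∣ j))

binomial≤count : ∀ {n} (φ : Family n) X j → (∀ B → B ⊆ X → ∣ B ∣ ≡ j → B ∈ᶠ φ) →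
                 ∣ X ∣ choose j ≤ count (layer j (φ within X))
binomial≤count φ X j all-in =
  ≤-trans (≤-reflexive (sym (count-layer-𝒫 X j))) (count-mono subsets-in)
  where
  subsets-in : layer j (𝒫 X) ⊑ layer j (φ within X)
  subsets-in B B∈ =
    let B⊆X , ∣B∣≡j = ∈∩ᶠ⁻ (𝒫 X) (sized j) B B∈
        B∈φ = all-in B (does⇒ (B ⊆? X) B⊆X) (does⇒ (∣ B ∣ ≟ j) ∣B∣≡j)
    in ∈∩ᶠ⁺ (φ within X) (sized j) B (∈∩ᶠ⁺ φ (𝒫 X) B B∈φ B⊆X) ∣B∣≡j

between : ∀ {n} {U V : Subset n} k → U ⊆ V → ∣ U ∣ ≤ k → k ≤ ∣ V ∣ →
          Σ[ X ∈ Subset n ] (U ⊆ X × X ⊆ V × ∣ X ∣ ≡ k)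
between {U = []} {[]} k _ _ k≤0 = [] , id , id , sym (n≤0⇒n≡0 k≤0)
between {U = inside ∷ U} {inside ∷ V} zero _ () _
between {U = inside ∷ U} {inside ∷ V} (suc k) U⊆V (s≤s U≤k) (s≤s k≤V) =
  let X , U⊆X , X⊆V , ∣X∣≡k = between k (drop-∷-⊆ U⊆V) U≤k k≤V
  in inside ∷ X , s⊆s U⊆X , s⊆s X⊆V , cong suc ∣X∣≡k
between {U = inside ∷ U} {outside ∷ V} k U⊆V _ _ with U⊆V Vec.here
... | ()
between {U = outside ∷ U} {outside ∷ V} k U⊆V U≤k k≤V =
  let X , U⊆X , X⊆V , ∣X∣≡k = between k (drop-∷-⊆ U⊆V) U≤k k≤V
  in outside ∷ X , s⊆s U⊆X , s⊆s X⊆V , ∣X∣≡k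
between {U = outside ∷ U} {inside ∷ V} k U⊆V U≤k k≤1+V with k ≤? ∣ V ∣
... | yes k≤V =
  let X , U⊆X , X⊆V , ∣X∣≡k = between k (drop-∷-⊆ U⊆V) U≤k k≤V
  in outside ∷ X , s⊆s U⊆X , out⊆ X⊆V , ∣X∣≡k
... | no k≰V = inside ∷ V , out⊆ (drop-∷-⊆ U⊆V) , ⊆-refl , ≤-antisym (≰⇒> k≰V) k≤1+V

∣p∪q∣+∣p∩q∣≡∣p∣+∣q∣ : ∀ {n} (p q : Subset n) → ∣ p ∪ q ∣ + ∣ p ∩ q ∣ ≡ ∣ p ∣ + ∣ q ∣
∣p∪q∣+∣p∩q∣≡∣p∣+∣q∣ []            []            = refl
∣p∪q∣+∣p∩q∣≡∣p∣+∣q∣ (outside ∷ p) (outside ∷ q) = ∣p∪q∣+∣p∩q∣≡∣p∣+∣q∣ p q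
∣p∪q∣+∣p∩q∣≡∣p∣+∣q∣ (outside ∷ p) (inside  ∷ q) =
  trans (cong suc (∣p∪q∣+∣p∩q∣≡∣p∣+∣q∣ p q)) (sym (+-suc ∣ p ∣ ∣ q ∣))
∣p∪q∣+∣p∩q∣≡∣p∣+∣q∣ (inside  ∷ p) (outside ∷ q) = cong suc (∣p∪q∣+∣p∩q∣≡∣p∣+∣q∣ p q)
∣p∪q∣+∣p∩q∣≡∣p∣+∣q∣ (inside  ∷ p) (inside  ∷ q) = cong suc (begin
  ∣ p ∪ q ∣ + suc ∣ p ∩ q ∣   ≡⟨ +-suc ∣ p ∪ q ∣ ∣ p ∩ q ∣ ⟩
  suc (∣ p ∪ q ∣ + ∣ p ∩ q ∣) ≡⟨ cong suc (∣p∪q∣+∣p∩q∣≡∣p∣+∣q∣ p q) ⟩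
  suc (∣ p ∣ + ∣ q ∣)         ≡⟨ +-suc ∣ p ∣ ∣ q ∣ ⟨
  ∣ p ∣ + suc ∣ q ∣           ∎)
  where open ≡-Reasoning

∣p∪q∣≤∣p∣+∣q∣ : ∀ {n} (p q : Subset n) → ∣ p ∪ q ∣ ≤ ∣ p ∣ + ∣ q ∣
∣p∪q∣≤∣p∣+∣q∣ p q = ≤-trans (m≤m+n ∣ p ∪ q ∣ ∣ p ∩ q ∣) (≤-reflexive (∣p∪q∣+∣p∩q∣≡∣p∣+∣q∣ p q))

∪-⊆ : ∀ {n} {p q r : Subset n} → p ⊆ r → q ⊆ r → p ∪ q ⊆ r
∪-⊆ {p = p} {q} p⊆r q⊆r x∈p∪q = [ p⊆r , q⊆r ] (x∈p∪q⁻ p q x∈p∪q)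

x∈p⇒⁅x⁆⊆p : ∀ {n} {x : Fin n} {p : Subset n} → x ∈ p → ⁅ x ⁆ ⊆ p
x∈p⇒⁅x⁆⊆p {x = x} {p} x∈p y∈⁅x⁆ = subst (_∈ p) (sym (x∈⁅y⁆⇒x≡y x y∈⁅x⁆)) x∈p

x∈p⇒1≤∣p∣ : ∀ {n} {x : Fin n} {p : Subset n} → x ∈ p → 1 ≤ ∣ p ∣
x∈p⇒1≤∣p∣ {x = x} x∈p = subst (_≤ _) (∣⁅x⁆∣≡1 x) (p⊆q⇒∣p∣≤∣q∣ (x∈p⇒⁅x⁆⊆p x∈p))

1≤∣p∣⇒nonempty : ∀ {n} (p : Subset n) → 1 ≤ ∣ p ∣ → Nonempty p
1≤∣p∣⇒nonempty (inside  ∷ p) _     = zero , Vec.here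
1≤∣p∣⇒nonempty (outside ∷ p) 1≤∣p∣ =
  let x , x∈p = 1≤∣p∣⇒nonempty p 1≤∣p∣ in suc x , Vec.there x∈p

∣p∣≡0⇒p≡∅ : ∀ {n} (p : Subset n) → ∣ p ∣ ≡ 0 → p ≡ ∅
∣p∣≡0⇒p≡∅ []            _     = refl
∣p∣≡0⇒p≡∅ (outside ∷ p) ∣p∣≡0 = cong (outside ∷_) (∣p∣≡0⇒p≡∅ p ∣p∣≡0)

∣p∣≡1⇒p≡⁅x⁆ : ∀ {n} (p : Subset n) → ∣ p ∣ ≡ 1 → Σ[ x ∈ Fin n ] p ≡ ⁅ x ⁆
∣p∣≡1⇒p≡⁅x⁆ (inside  ∷ p) ∣p∣≡1 = zero , cong (inside ∷_) (∣p∣≡0⇒p≡∅ p (suc-injective ∣p∣≡1))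
∣p∣≡1⇒p≡⁅x⁆ (outside ∷ p) ∣p∣≡1 =
  let x , p≡⁅x⁆ = ∣p∣≡1⇒p≡⁅x⁆ p ∣p∣≡1 in suc x , cong (outside ∷_) p≡⁅x⁆

weight : ∀ {n} → Family n → ℕ
weight φ = ∑ (λ A → 𝟙 (φ A) * ∣ A ∣)

k*count≤weight : ∀ {n} (φ : Family n) k → (∀ A → A ∈ᶠ φ → k ≤ ∣ A ∣) → k * count φ ≤ weight φ
k*count≤weight φ k k≤size = begin
  k * count φ            ≡⟨ ∑-*ˡ k (𝟙 ∘ φ) ⟨
  ∑ (λ A → k * 𝟙 (φ A))  ≤⟨ ∑-mono (λ A → pointwise A (φ A) refl) ⟩
  weight φ               ∎
  where
  open ≤-Reasoning
  pointwise : ∀ A b → φ A ≡ b → k * 𝟙 b ≤ 𝟙 b * ∣ A ∣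
  pointwise A false _    = ≤-reflexive (*-zeroʳ k)
  pointwise A true  φA≡b = begin
    k * 1      ≡⟨ *-identityʳ k ⟩
    k          ≤⟨ k≤size A (subst T (sym φA≡b) tt) ⟩
    ∣ A ∣      ≡⟨ +-identityʳ ∣ A ∣ ⟨
    1 * ∣ A ∣  ∎

-- Each member of the upper half contributes its first point to the weight.
weight-suc : ∀ {n} (φ : Family (suc n)) →
             weight φ ≡ weight (φ ⁰) + (count (φ ¹) + weight (φ ¹))
weight-suc φ = cong (weight (φ ⁰) +_)
  (trans (∑-cong (λ A → *-suc (𝟙 (φ (inside ∷ A))) ∣ A ∣))
         (∑-+ (𝟙 ∘ φ ¹) (λ A → 𝟙 (φ (inside ∷ A)) * ∣ A ∣)))

weight-∪∩ : ∀ {n} (φ ψ : Family n) → weight (φ ∪ᶠ ψ) + weight (φ ∩ᶠ ψ) ≡ weight φ + weight ψ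
weight-∪∩ φ ψ = begin
  weight (φ ∪ᶠ ψ) + weight (φ ∩ᶠ ψ)
    ≡⟨ ∑-+ (λ A → 𝟙 (φ A ∨ ψ A) * ∣ A ∣) (λ A → 𝟙 (φ A ∧ ψ A) * ∣ A ∣) ⟨
  ∑ (λ A → 𝟙 (φ A ∨ ψ A) * ∣ A ∣ + 𝟙 (φ A ∧ ψ A) * ∣ A ∣)
    ≡⟨ ∑-cong (λ A → pointwise (φ A) (ψ A) ∣ A ∣) ⟩
  ∑ (λ A → 𝟙 (φ A) * ∣ A ∣ + 𝟙 (ψ A) * ∣ A ∣)
    ≡⟨ ∑-+ (λ A → 𝟙 (φ A) * ∣ A ∣) (λ A → 𝟙 (ψ A) * ∣ A ∣) ⟩
  weight φ + weight ψ ∎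
  where
  open ≡-Reasoning
  pointwise : ∀ a b s → 𝟙 (a ∨ b) * s + 𝟙 (a ∧ b) * s ≡ 𝟙 a * s + 𝟙 b * s
  pointwise false b     s = +-identityʳ (𝟙 b * s)
  pointwise true  false s = refl
  pointwise true  true  s = refl

weight-witness : ∀ {n} (φ : Family n) → 0 < weight φ →
                 Σ[ A ∈ Subset n ] Σ[ x ∈ Fin n ] (A ∈ᶠ φ × x ∈ A)
weight-witness {n} φ 0<w =
  let A , 0<term = ∑-<-witness (λ A → 𝟙 (φ A) * ∣ A ∣) (λ _ → 0)
                               (subst (_< weight φ) (sym (∑-zero {n})) 0<w)
  in witness A (φ A) refl 0<term
  where
  witness : ∀ A b → φ A ≡ b → 0 < 𝟙 b * ∣ A ∣ →
            Σ[ A ∈ Subset n ] Σ[ x ∈ Fin n ] (A ∈ᶠ φ × x ∈ A)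
  witness A true φA≡b 0<∣A∣ =
    let x , x∈A = 1≤∣p∣⇒nonempty A (subst (1 ≤_) (+-identityʳ ∣ A ∣) 0<∣A∣)
    in A , x , subst T (sym φA≡b) tt , x∈A

two-members : ∀ {n} (φ : Family n) → 2 ≤ count φ →
              Σ[ A ∈ Subset n ] Σ[ B ∈ Subset n ] (A ∈ᶠ φ × B ∈ᶠ φ × A ≢ B)
two-members φ 2≤φ =
  let A , A∈φ , _     = fresh-member φ [] [] (≤-trans (s≤s z≤n) 2≤φ)
      B , B∈φ , B∉[A] = fresh-member φ (A ∷ []) ([] ∷ []) 2≤φ
  in A , B , A∈φ , B∈φ , λ A≡B → B∉[A] (here (sym A≡B))

lift-member : ∀ {n} (φ : Family (suc n)) A → A ∈ᶠ φ ⁰ ∪ᶠ φ ¹ → Σ[ s ∈ Bool ] (s ∷ A) ∈ᶠ φ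
lift-member φ A A∈ with ∈∪ᶠ⁻ (φ ⁰) (φ ¹) A A∈
... | inj₁ A∈φ⁰ = outside , A∈φ⁰
... | inj₂ A∈φ¹ = inside  , A∈φ¹

projection-weight : ∀ {n} (φ : Family (suc n)) → count (φ ¹) ≤ 1 →
                    weight (φ ⁰ ∩ᶠ φ ¹) ≡ 0 → weight φ ≤ suc (weight (φ ⁰ ∪ᶠ φ ¹))
projection-weight φ φ¹≤1 W∩≡0 = begin
  weight φ                  ≡⟨ weight-suc φ ⟩
  W₀ + (count (φ ¹) + W₁)   ≤⟨ +-monoʳ-≤ W₀ (+-monoˡ-≤ W₁ φ¹≤1) ⟩
  W₀ + suc W₁               ≡⟨ +-suc W₀ W₁ ⟩
  suc (W₀ + W₁)             ≡⟨ cong suc (weight-∪∩ (φ ⁰) (φ ¹)) ⟨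
  suc (W∪ + weight (φ ⁰ ∩ᶠ φ ¹)) ≡⟨ cong (λ w → suc (W∪ + w)) W∩≡0 ⟩
  suc (W∪ + 0)              ≡⟨ cong suc (+-identityʳ W∪) ⟩
  suc W∪                    ∎
  where
  open ≤-Reasoning
  W₀ W₁ W∪ : ℕ
  W₀ = weight (φ ⁰)
  W₁ = weight (φ ¹)
  W∪ = weight (φ ⁰ ∪ᶠ φ ¹)

Overlap : ∀ {n} → Family n → Set
Overlap {n} φ = Σ[ A ∈ Subset n ] Σ[ B ∈ Subset n ] Σ[ x ∈ Fin n ]
                  (A ∈ᶠ φ × B ∈ᶠ φ × A ≢ B × x ∈ A × x ∈ B)

-- Either two members of the upper half share the
-- first point, or some nonempty set lies in both halves, or the projection
-- φ⁰ ∪ φ¹ still has weight exceeding n - 1.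
pigeonhole : ∀ {n} (φ : Family n) → n < weight φ → Overlap φ
pigeonhole {zero}  φ 0<w = contradiction (*-zeroʳ (𝟙 (φ []))) (>⇒≢ 0<w)
pigeonhole {suc n} φ n<w with 2 ≤? count (φ ¹) | 1 ≤? weight (φ ⁰ ∩ᶠ φ ¹)
... | yes 2≤φ¹ | _ =
  let A , B , A∈ , B∈ , A≢B = two-members (φ ¹) 2≤φ¹
  in inside ∷ A , inside ∷ B , zero , A∈ , B∈ , A≢B ∘ ∷-injectiveʳ , Vec.here , Vec.here
... | no _ | yes 0<W∩ =
  let A , x , A∈ , x∈A = weight-witness (φ ⁰ ∩ᶠ φ ¹) 0<W∩
      A∈φ⁰ , A∈φ¹      = ∈∩ᶠ⁻ (φ ⁰) (φ ¹) A A∈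
  in outside ∷ A , inside ∷ A , suc x , A∈φ⁰ , A∈φ¹ , (λ ()) , Vec.there x∈A , Vec.there x∈A
... | no 2≰φ¹ | no 1≰W∩ =
  let A , B , x , A∈ , B∈ , A≢B , x∈A , x∈B = pigeonhole (φ ⁰ ∪ᶠ φ ¹) (≤-pred (≤-trans n<w W≤1+W∪))
      s , sA∈φ = lift-member φ A A∈
      t , tB∈φ = lift-member φ B B∈
  in s ∷ A , t ∷ B , suc x , sA∈φ , tB∈φ , A≢B ∘ ∷-injectiveʳ , Vec.there x∈A , Vec.there x∈B
  where
  W≤1+W∪ : weight φ ≤ suc (weight (φ ⁰ ∪ᶠ φ ¹))
  W≤1+W∪ = projection-weight φ (≤-pred (≰⇒> 2≰φ¹)) (n<1⇒n≡0 (≰⇒> 1≰W∩))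

3n≤2⌊3n/2⌋+1 : ∀ n → 3 * n ≤ 2 * ((3 * n) / 2) + 1
3n≤2⌊3n/2⌋+1 n = begin
  3 * n                ≡⟨ m≡m%n+[m/n]*n (3 * n) 2 ⟩
  (3 * n) % 2 + q * 2  ≤⟨ +-monoˡ-≤ (q * 2) (≤-pred (m%n<n (3 * n) 2)) ⟩
  1 + q * 2            ≡⟨ trans (+-comm 1 (q * 2)) (cong (_+ 1) (*-comm q 2)) ⟩
  2 * q + 1            ∎
  where
  open ≤-Reasoning
  q : ℕ
  q = (3 * n) / 2

9≤⌊3n/2⌋+2 : ∀ {n} → 6 ≤ n → 9 ≤ (3 * n) / 2 + 2
9≤⌊3n/2⌋+2 {n} 6≤n = ≤-trans (/-monoˡ-≤ 2 (*-monoʳ-≤ 3 6≤n)) (m≤m+n ((3 * n) / 2) 2)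

n<2c : ∀ n c → (3 * n) / 2 + 2 ≤ 1 + n + c → n < 2 * c
n<2c n c bound = +-cancelˡ-≤ (2 + 2 * n) (suc n) (2 * c) (begin
  2 + 2 * n + suc n  ≡⟨ lhs n ⟩
  3 * n + 3          ≤⟨ +-monoˡ-≤ 3 (3n≤2⌊3n/2⌋+1 n) ⟩
  2 * q + 1 + 3      ≡⟨ middle q ⟩
  2 * (q + 2)        ≤⟨ *-monoʳ-≤ 2 bound ⟩
  2 * (1 + n + c)    ≡⟨ rhs n c ⟩
  2 + 2 * n + 2 * c  ∎)
  where
  open ≤-Reasoning
  q : ℕ
  q = (3 * n) / 2
  lhs : ∀ n → 2 + 2 * n + suc n ≡ 3 * n + 3
  lhs = solve-∀
  middle : ∀ q → 2 * q + 1 + 3 ≡ 2 * (q + 2)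
  middle = solve-∀
  rhs : ∀ n c → 2 * (1 + n + c) ≡ 2 + 2 * n + 2 * c
  rhs = solve-∀

3≤c : ∀ {n c} → 6 ≤ n → n < 2 * c → 3 ≤ c
3≤c {n} {c} 6≤n n<2c = <⇒≤ (*-cancelˡ-< 2 3 c (≤-<-trans 6≤n n<2c))

module DownClosedFamily {n : ℕ} (ψ : Family n) (down : DownClosed ψ) where

  V : Subset n
  V = tabulate (λ x → ψ ⁅ x ⁆)

  ⁅x⁆∈ψ : ∀ {x} → x ∈ V → ⁅ x ⁆ ∈ᶠ ψ
  ⁅x⁆∈ψ {x} x∈V =
    Equivalence.from T-≡ (trans (sym (lookup∘tabulate (λ y → ψ ⁅ y ⁆) x)) ([]=⇒lookup x∈V))

  member⊆V : ∀ {A} → A ∈ᶠ ψ → A ⊆ V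
  member⊆V A∈ψ {x} x∈A = lookup⇒[]= x V
    (trans (lookup∘tabulate (λ y → ψ ⁅ y ⁆) x)
           (Equivalence.to T-≡ (down (x∈p⇒⁅x⁆⊆p x∈A) A∈ψ)))

  count-layer≤ : ∀ j → count (layer j ψ) ≤ ∣ V ∣ choose j
  count-layer≤ j = ≤-trans
    (count-mono (∩ᶠ-mono (λ A A∈ψ → ⇒does (A ⊆? V) (member⊆V A∈ψ)) (λ _ → id)))
    (≤-reflexive (count-layer-𝒫 V j))

  -- Without members of size ≥ 3, ψ has at most 1 + n + (number of pairs)
  -- members: at most one empty set and at most n singletons.
  count≤1+n+pairs : count (large ψ) ≡ 0 → count ψ ≤ 1 + n + count (layer 2 ψ)
  count≤1+n+pairs no-large = begin
    count ψ                         ≡⟨ count-layers ψ ⟩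
    c₀ + c₁ + c₂ + count (large ψ)  ≡⟨ cong (c₀ + c₁ + c₂ +_) no-large ⟩
    c₀ + c₁ + c₂ + 0                ≡⟨ +-identityʳ _ ⟩
    c₀ + c₁ + c₂                    ≤⟨ +-monoˡ-≤ c₂ (+-mono-≤ (count-layer≤ 0) singletons≤n) ⟩
    1 + n + c₂                      ∎
    where
    open ≤-Reasoning
    c₀ c₁ c₂ : ℕ
    c₀ = count (layer 0 ψ)
    c₁ = count (layer 1 ψ)
    c₂ = count (layer 2 ψ)
    singletons≤n : c₁ ≤ n
    singletons≤n = ≤-trans (count-layer≤ 1) (≤-trans (≤-reflexive (nC1≡n ∣ V ∣)) (∣p∣≤n V))

  record Core : Set where
    field
      U           : Subset n
      U⊆V         : U ⊆ V
      ∣U∣≤5       : ∣ U ∣ ≤ 5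
      three-pairs : 3 ≤ count (layer 2 (ψ within U))

  -- A member with at least three points yields a core: three of its points
  -- span three pairs, all members by down-closure.
  large-member⇒core : ∀ {A} → A ∈ᶠ ψ → 3 ≤ ∣ A ∣ → Core
  large-member⇒core {A} A∈ψ 3≤∣A∣ = record
    { U           = S
    ; U⊆V         = ⊆-trans S⊆A (member⊆V A∈ψ)
    ; ∣U∣≤5       = ≤-trans (≤-reflexive ∣S∣≡3) (s≤s (s≤s (s≤s z≤n)))
    ; three-pairs = subst (_≤ count (layer 2 (ψ within S))) (cong (_choose 2) ∣S∣≡3)
                          (binomial≤count ψ S 2 (λ B B⊆S _ → down (⊆-trans B⊆S S⊆A) A∈ψ))
    }
    where
    three-subset : Σ[ S ∈ Subset n ] (∅ ⊆ S × S ⊆ A × ∣ S ∣ ≡ 3)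
    three-subset = between 3 ⊥⊆ (≤-trans (≤-reflexive (∣⊥∣≡0 n)) z≤n) 3≤∣A∣
    S : Subset n
    S = proj₁ three-subset
    S⊆A : S ⊆ A
    S⊆A = proj₁ (proj₂ (proj₂ three-subset))
    ∣S∣≡3 : ∣ S ∣ ≡ 3
    ∣S∣≡3 = proj₂ (proj₂ (proj₂ three-subset))

  pairs⇒core : ∀ {A B C x} → A ∈ᶠ layer 2 ψ → B ∈ᶠ layer 2 ψ → C ∈ᶠ layer 2 ψ →
               Unique (A ∷ B ∷ C ∷ []) → x ∈ A → x ∈ B → Core
  pairs⇒core {A} {B} {C} A∈ B∈ C∈ distinct x∈A x∈B = record
    { U           = U
    ; U⊆V         = ∪-⊆ (∪-⊆ (pair⊆V A∈) (pair⊆V B∈)) (pair⊆V C∈)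
    ; ∣U∣≤5       = ≤-trans (∣p∪q∣≤∣p∣+∣q∣ (A ∪ B) C)
                            (+-mono-≤ ∣A∪B∣≤3 (≤-reflexive (layer-size ψ 2 C C∈)))
    ; three-pairs = length≤count (A ∷ B ∷ C ∷ []) distinct inside-U
    }
    where
    U : Subset n
    U = (A ∪ B) ∪ C
    pair⊆V : ∀ {P} → P ∈ᶠ layer 2 ψ → P ⊆ V
    pair⊆V {P} P∈ = member⊆V (layer-member ψ 2 P P∈)
    ∣A∪B∣≤3 : ∣ A ∪ B ∣ ≤ 3
    ∣A∪B∣≤3 = +-cancelʳ-≤ 1 ∣ A ∪ B ∣ 3 (begin
      ∣ A ∪ B ∣ + 1          ≤⟨ +-monoʳ-≤ ∣ A ∪ B ∣ (x∈p⇒1≤∣p∣ (x∈p∩q⁺ (x∈A , x∈B))) ⟩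
      ∣ A ∪ B ∣ + ∣ A ∩ B ∣  ≡⟨ ∣p∪q∣+∣p∩q∣≡∣p∣+∣q∣ A B ⟩
      ∣ A ∣ + ∣ B ∣          ≡⟨ cong₂ _+_ (layer-size ψ 2 A A∈) (layer-size ψ 2 B B∈) ⟩
      4                      ∎)
      where open ≤-Reasoning
    inside-U : ∀ {P} → P ∈ˡ A ∷ B ∷ C ∷ [] → P ∈ᶠ layer 2 (ψ within U)
    inside-U (here refl)                 = layer-within ψ 2 A A∈ (⊆-trans (p⊆p∪q B) (p⊆p∪q C))
    inside-U (there (here refl))         = layer-within ψ 2 B B∈ (⊆-trans (q⊆p∪q A B) (p⊆p∪q C))
    inside-U (there (there (here refl))) = layer-within ψ 2 C C∈ (q⊆p∪q (A ∪ B) C)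

  -- At least three and more than n/2 pairs yield a core: by pigeonhole two
  -- pairs share a point, and any third pair completes the core.
  many-pairs⇒core : 3 ≤ count (layer 2 ψ) → n < 2 * count (layer 2 ψ) → Core
  many-pairs⇒core 3≤pairs n<2pairs =
    let A , B , x , A∈ , B∈ , A≢B , x∈A , x∈B = pigeonhole (layer 2 ψ) n<weight
        C , C∈ , C∉AB = fresh-member (layer 2 ψ) (A ∷ B ∷ []) ((A≢B ∷ []) ∷ [] ∷ []) 3≤pairs
        distinct : Unique (A ∷ B ∷ C ∷ [])
        distinct = (A≢B ∷ (λ A≡C → C∉AB (here (sym A≡C))) ∷ [])
                 ∷ ((λ B≡C → C∉AB (there (here (sym B≡C)))) ∷ [])
                 ∷ [] ∷ []
    in pairs⇒core A∈ B∈ C∈ distinct x∈A x∈B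
    where
    n<weight : n < weight (layer 2 ψ)
    n<weight = <-≤-trans n<2pairs
      (k*count≤weight (layer 2 ψ) 2 (λ P P∈ → ≤-reflexive (sym (layer-size ψ 2 P P∈))))

  find-core : 6 ≤ n → (3 * n) / 2 + 2 ≤ count ψ → Core
  find-core 6≤n enough with 1 ≤? count (large ψ)
  ... | yes 1≤large =
    let A , A∈large , _ = fresh-member (large ψ) [] [] 1≤large
        A∈ψ , 3≤∣A∣     = ∈∩ᶠ⁻ ψ (λ A → does (3 ≤? ∣ A ∣)) A A∈large
    in large-member⇒core A∈ψ (does⇒ (3 ≤? ∣ A ∣) 3≤∣A∣)
  ... | no 1≰large = many-pairs⇒core (3≤c 6≤n n<2pairs) n<2pairs
    where
    n<2pairs : n < 2 * count (layer 2 ψ)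
    n<2pairs = n<2c n _ (≤-trans enough (count≤1+n+pairs (n<1⇒n≡0 (≰⇒> 1≰large))))

  -- A five-set X ⊆ V containing three pairs of a nonempty ψ contains nine
  -- members: ∅, its five singletons and the three pairs.
  nine-members : ∀ {A₀ X} → A₀ ∈ᶠ ψ → X ⊆ V → ∣ X ∣ ≡ 5 →
                 3 ≤ count (layer 2 (ψ within X)) → 9 ≤ count (ψ within X)
  nine-members {A₀} {X} A₀∈ψ X⊆V ∣X∣≡5 three-pairs = begin
    1 + 5 + 3                              ≤⟨ +-mono-≤ (+-mono-≤ empty five-singletons) three-pairs ⟩
    c₀ + c₁ + c₂                           ≤⟨ m≤m+n (c₀ + c₁ + c₂) (count (large (ψ within X))) ⟩
    c₀ + c₁ + c₂ + count (large (ψ within X)) ≡⟨ count-layers (ψ within X) ⟨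
    count (ψ within X)                     ∎
    where
    open ≤-Reasoning
    c₀ c₁ c₂ : ℕ
    c₀ = count (layer 0 (ψ within X))
    c₁ = count (layer 1 (ψ within X))
    c₂ = count (layer 2 (ψ within X))
    empty : 1 ≤ c₀
    empty = binomial≤count ψ X 0 (λ B _ ∣B∣≡0 →
      down (subst (_⊆ A₀) (sym (∣p∣≡0⇒p≡∅ B ∣B∣≡0)) ⊥⊆) A₀∈ψ)
    singleton∈ψ : ∀ B → B ⊆ X → ∣ B ∣ ≡ 1 → B ∈ᶠ ψ
    singleton∈ψ B B⊆X ∣B∣≡1 with ∣p∣≡1⇒p≡⁅x⁆ B ∣B∣≡1
    ... | x , refl = ⁅x⁆∈ψ (X⊆V (B⊆X (x∈⁅x⁆ x)))
    five-singletons : 5 ≤ c₁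
    five-singletons = subst (_≤ c₁) (trans (nC1≡n ∣ X ∣) ∣X∣≡5) (binomial≤count ψ X 1 singleton∈ψ)

  core⇒five-set : ∀ {A₀} → A₀ ∈ᶠ ψ → 5 ≤ ∣ V ∣ → Core →
                  Σ[ X ∈ Subset n ] (∣ X ∣ ≡ 5 × 9 ≤ count (ψ within X))
  core⇒five-set A₀∈ψ 5≤∣V∣ core =
    let X , U⊆X , X⊆V , ∣X∣≡5 = between 5 U⊆V ∣U∣≤5 5≤∣V∣
        pairs-in-X = ≤-trans three-pairs (count-mono (∩ᶠ-mono (within-mono ψ U⊆X) (λ _ → id)))
    in X , ∣X∣≡5 , nine-members A₀∈ψ X⊆V ∣X∣≡5 pairs-in-X
    where open Core core

  small-V⇒five-set : ∣ V ∣ ≤ 5 → 5 ≤ n →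
                     Σ[ X ∈ Subset n ] (∣ X ∣ ≡ 5 × count ψ ≤ count (ψ within X))
  small-V⇒five-set ∣V∣≤5 5≤n =
    let X , V⊆X , _ , ∣X∣≡5 = between 5 (⊆⊤ {p = V}) ∣V∣≤5 (subst (5 ≤_) (sym (∣⊤∣≡n n)) 5≤n)
    in X , ∣X∣≡5 , count-mono (λ A A∈ψ →
         ∈∩ᶠ⁺ ψ (𝒫 X) A A∈ψ (⇒does (A ⊆? X) (⊆-trans (member⊆V A∈ψ) V⊆X)))

  nine-in-five : 6 ≤ n → (3 * n) / 2 + 2 ≤ count ψ →
                 Σ[ X ∈ Subset n ] (∣ X ∣ ≡ 5 × 9 ≤ count (ψ within X))
  nine-in-five 6≤n enough = by-size-of-V (5 ≤? ∣ V ∣)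
    where
    nine≤count : 9 ≤ count ψ
    nine≤count = ≤-trans (9≤⌊3n/2⌋+2 6≤n) enough
    by-size-of-V : Dec (5 ≤ ∣ V ∣) → Σ[ X ∈ Subset n ] (∣ X ∣ ≡ 5 × 9 ≤ count (ψ within X))
    by-size-of-V (yes 5≤∣V∣) =
      let A₀ , A₀∈ψ , _ = fresh-member ψ [] [] (≤-trans (s≤s z≤n) nine≤count)
      in core⇒five-set A₀∈ψ 5≤∣V∣ (find-core 6≤n enough)
    by-size-of-V (no 5≰∣V∣) =
      let X , ∣X∣≡5 , all-inside = small-V⇒five-set (<⇒≤ (≰⇒> 5≰∣V∣)) (≤-trans (n≤1+n 5) 6≤n)
      in X , ∣X∣≡5 , ≤-trans nine≤count all-inside

lemma2p5 : (n : ℕ) → n ≥ 6 → Arrow n ((3 * n) / 2 + 2) 5 9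
lemma2p5 n 6≤n 𝓕 unique ∣𝓕∣≡m =
  let X , ∣X∣≡5 , nine = DownClosedFamily.nine-in-five ψ (compress-downClosed ⟪ 𝓕 ⟫) 6≤n enough
  in X , ∣X∣≡5 , (begin
    9                        ≤⟨ nine ⟩
    count (ψ within X)       ≤⟨ compress-within≤traces ⟪ 𝓕 ⟫ X ⟩
    count (traces ⟪ 𝓕 ⟫ X)   ≤⟨ count-traces≤traceSize 𝓕 X ⟩
    traceSize 𝓕 X            ∎)
  where
  open ≤-Reasoning
  ψ : Family n
  ψ = compress ⟪ 𝓕 ⟫
  enough : (3 * n) / 2 + 2 ≤ count ψ
  enough = ≤-reflexive (sym (trans (count-compress ⟪ 𝓕 ⟫) (trans (count-⟪⟫ 𝓕 unique) ∣𝓕∣≡m)))
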